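{- A connected graph $G=(V,E)$ satisfies $\mathrm{AC}(G)=1$ if and only if there is a partition $V=A\cup B\cup C$ with $A=\{a_i\}_{i=1}^k$ and $B=\{b_i\}_{i=1}^k$ for some $k\in\mathbb{N}$ and $C=V\setminus(A\cup B)$ such that: (1) $(a_i,b_i)\in E$ for all $i\in[k]$; (2) for all $i\ne j\in[k]$, $(a_i,b_j)\in E$ or $(a_j,b_i)\in E$; (3) for all $i\ne j\in[k]$, $(a_i,a_j)\in E$ or $(b_i,b_j)\in E$; (4) $C$ induces a clique in $G$; (5) for all $c\in C$ and all $i\in[k]$, $(c,a_i)\in E$ or $(c,b_i)\in E$. (All "or" statements are non-exclusive.)
   Context: Acquaintance time: for a connected graph, place one agent on each vertex. Two agents are acquainted once they occupy the two endpoints of a common edge at some time (including the initial placement). In each round one chooses a matching (set of pairwise vertex-disjoint edges, not necessarily maximal), and for every edge of it the two agents on its endpoints swap places. A strategy for acquaintance is a sequence of matchings after which every pair of agents has been acquainted; $\mathrm{AC}(G)$ is the minimum number of rounds in such a strategy. $[k]=\{1,\dots,k\}$. -}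

module Defs where

open import Data.Nat using (ℕ; zero; suc)
open import Data.Fin using (Fin)
open import Data.List using (List; []; _∷_)
open import Data.Product using (Σ; ∃; _×_; _,_)
open import Data.Sum using (_⊎_)
open import Relation.Binary.PropositionalEquality using (_≡_; _≢_)
open import Relation.Nullary using (¬_)

record Graph (n : ℕ) : Set₁ where
  field
    Adj     : Fin n → Fin n → Set
    sym     : ∀ {u v} → Adj u v → Adj v u
    irrefl  : ∀ {v} → ¬ Adj v v
open Graph public

data Reachable {n : ℕ} (G : Graph n) : Fin n → Fin n → Set where
  here : ∀ {v} → Reachable G v v
  step : ∀ {u v w} → Adj G u v → Reachable G v w → Reachable G u w

Connected : ∀ {n} → Graph n → Set
Connected {n} G = ∀ (u v : Fin n) → Reachable G u v

-- A matching, encoded as an involution σ of the vertex set: σ v = v means v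
-- is unmatched, otherwise {v , σ v} is an edge of the matching.
record Matching {n : ℕ} (G : Graph n) : Set where
  field
    σ       : Fin n → Fin n
    invol   : ∀ v → σ (σ v) ≡ v
    isEdge  : ∀ v → σ v ≢ v → Adj G v (σ v)
open Matching public

-- Agents are named by their initial vertex (agent x starts on vertex x).
-- position after applying the matchings of a list, in order:
-- swapping along a matching moves the agent on vertex v to vertex σ v.
Strategy : ∀ {n} → Graph n → Set
Strategy G = List (Matching G)

-- AcquaintedFrom G p S x y : agents x and y are adjacent at some time,
-- where p is the current placement (agent ↦ vertex) and S the remaining rounds.
AcquaintedFrom : ∀ {n} (G : Graph n) → (Fin n → Fin n) → Strategy G → Fin n → Fin n → Set
AcquaintedFrom G p []       x y = Adj G (p x) (p y)
AcquaintedFrom G p (M ∷ S) x y =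
  Adj G (p x) (p y) ⊎ AcquaintedFrom G (λ a → σ M (p a)) S x y

IsAcquaintanceStrategy : ∀ {n} (G : Graph n) → Strategy G → Set
IsAcquaintanceStrategy {n} G S =
  ∀ (x y : Fin n) → x ≢ y → AcquaintedFrom G (λ a → a) S x y

len : ∀ {A : Set} → List A → ℕ
len []      = zero
len (_ ∷ xs) = suc (len xs)

-- AC(G) ≤ m : there is a strategy for acquaintance with (exactly) m rounds
-- (equivalently at most m, since empty matchings are allowed).
ACatMost : ∀ {n} → Graph n → ℕ → Set
ACatMost G m = Σ (Strategy G) λ S → len S ≡ m × IsAcquaintanceStrategy G S

record GoodPartition {n : ℕ} (G : Graph n) : Set where
  field
    k      : ℕ
    a b    : Fin k → Fin n
    a-inj  : ∀ i j → a i ≡ a j → i ≡ j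
    b-inj  : ∀ i j → b i ≡ b j → i ≡ j
    ab-dis : ∀ i j → a i ≢ b j
  InC : Fin n → Set
  InC c = (∀ i → c ≢ a i) × (∀ i → c ≢ b i)
  field
    cond1 : ∀ i → Adj G (a i) (b i)
    cond2 : ∀ i j → i ≢ j → Adj G (a i) (b j) ⊎ Adj G (a j) (b i)
    cond3 : ∀ i j → i ≢ j → Adj G (a i) (a j) ⊎ Adj G (b i) (b j)
    cond4 : ∀ c d → InC c → InC d → c ≢ d → Adj G c d
    cond5 : ∀ c → InC c → ∀ i → Adj G c (a i) ⊎ Adj G c (b i)

module Submission where

-- A one-round strategy is a single matching M, seen as an involution σ of the
-- vertices; it acquaints every pair iff for all distinct x, y the agents are
-- adjacent either initially (x ~ y) or after the swap (σ x ~ σ y).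
--
-- (⇒) Enumerate, injectively, the vertices v with v < σ v (a general fact:
--     every decidable subset of Fin n has an injective enumeration).  These are
--     the a i, their partners b i = σ (a i), and every remaining vertex is
--     fixed by σ.  Conditions (1)-(5) are then the acquaintance property read
--     on the various kinds of pairs.
-- (⇐) Swap each a i with b i and fix every vertex of C.  Classifying every
--     vertex as some a i, some b i or a member of C shows that this is a
--     matching, and conditions (1)-(5) give the acquaintance of each kind of
--     pair.

open import Defs
open import Data.Nat using (ℕ; zero; suc)
open import Data.Fin using (Fin; zero; suc; _<_; _<?_; _≟_; lift)
open import Data.Fin.Properties using (<-cmp; <-asym; <-irrefl; suc-injective; lift-injective; any?)
open import Data.List using ([]; _∷_)
open import Data.Product using (Σ; _×_; _,_)
open import Data.Sum using (_⊎_; inj₁; inj₂; map; map₂; swap; [_,_])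
open import Data.Empty using (⊥-elim)
open import Relation.Nullary using (Dec; yes; no)
open import Relation.Binary using (tri<; tri≈; tri>)
open import Relation.Binary.PropositionalEquality
  using (_≡_; _≢_; refl; cong; subst; subst₂; trans) renaming (sym to ≡-sym)
open import Function using (_∘_)

record Enumeration (n : ℕ) (P : Fin n → Set) : Set where
  field
    size     : ℕ
    elem     : Fin size → Fin n
    injective : ∀ i j → elem i ≡ elem j → i ≡ j
    sound    : ∀ i → P (elem i)
    complete : ∀ v → P v → Σ (Fin size) λ i → elem i ≡ v
open Enumeration

enumerate : ∀ n (P : Fin n → Set) → (∀ v → Dec (P v)) → Enumeration n P
enumerate zero P P? =
  record { size = zero ; elem = λ () ; injective = λ () ; sound = λ () ; complete = λ () }
enumerate (suc n) P P? = extend (enumerate n (P ∘ suc) (P? ∘ suc)) (P? zero)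
  where
  shiftedComplete : (E : Enumeration n (P ∘ suc)) → ∀ v → P (suc v) →
                    Σ (Fin (size E)) λ i → suc (elem E i) ≡ suc v
  shiftedComplete E v pv = let (i , e) = complete E v pv in i , cong suc e

  extend : Enumeration n (P ∘ suc) → Dec (P zero) → Enumeration (suc n) P
  extend E (yes p₀) = record
    { size = suc (size E) ; elem = lift 1 (elem E)
    ; injective = λ i j → lift-injective (elem E) (λ {i} {j} → injective E i j) 1
    ; sound = sound′ ; complete = complete′ }
    where
    sound′ : ∀ i → P (lift 1 (elem E) i)
    sound′ zero    = p₀
    sound′ (suc i) = sound E i
    complete′ : ∀ v → P v → Σ (Fin (suc (size E))) λ i → lift 1 (elem E) i ≡ v
    complete′ zero    _  = zero , refl
    complete′ (suc v) pv = let (i , e) = shiftedComplete E v pv in suc i , e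
  extend E (no ¬p₀) = record
    { size = size E ; elem = suc ∘ elem E
    ; injective = λ i j → injective E i j ∘ suc-injective
    ; sound = sound E ; complete = complete′ }
    where
    complete′ : ∀ v → P v → Σ (Fin (size E)) λ i → suc (elem E i) ≡ v
    complete′ zero    pv = ⊥-elim (¬p₀ pv)
    complete′ (suc v) pv = shiftedComplete E v pv

-- A matching acquaints all pairs in one round: distinct agents are adjacent
-- before or after the swap.  IsAcquaintanceStrategy G (M ∷ []) unfolds to this.
OneRoundAcquainting : ∀ {n} (G : Graph n) → Matching G → Set
OneRoundAcquainting {n} G M =
  ∀ (x y : Fin n) → x ≢ y → Adj G x y ⊎ Adj G (σ M x) (σ M y)

module MatchedPairs {n} (G : Graph n) (M : Matching G) where

  σ-injective : ∀ u v → σ M u ≡ σ M v → u ≡ v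
  σ-injective u v e = trans (≡-sym (invol M u)) (trans (cong (σ M) e) (invol M v))

  Lower : Fin n → Set
  Lower v = v < σ M v

  lowers : Enumeration n Lower
  lowers = enumerate n Lower (λ v → v <? σ M v)

  k : ℕ
  k = size lowers

  a b : Fin k → Fin n
  a = elem lowers
  b i = σ M (a i)

  -- A smaller endpoint is never a larger one: a i = b j would give
  -- a i < a j (as σ (a i) = a j) and a j < a i.
  a≢b : ∀ i j → a i ≢ b j
  a≢b i j e = <-asym ai<aj aj<ai
    where
    ai<aj : a i < a j
    ai<aj = subst (a i <_) (trans (cong (σ M) e) (invol M (a j))) (sound lowers i)
    aj<ai : a j < a i
    aj<ai = subst (a j <_) (≡-sym e) (sound lowers j)

  matchedEdge : ∀ i → Adj G (a i) (b i)
  matchedEdge i = isEdge M (a i) λ e → <-irrefl (≡-sym e) (sound lowers i)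

  -- A vertex that is neither some a i nor some b i is unmatched: if c < σ c
  -- then c is an a i, and if σ c < c then σ c is an a i, so c = b i.
  unmatchedFixed : ∀ c → (∀ i → c ≢ a i) → (∀ i → c ≢ b i) → σ M c ≡ c
  unmatchedFixed c notA notB with <-cmp c (σ M c)
  ... | tri< c<σc _ _ =
    let (i , e) = complete lowers c c<σc in ⊥-elim (notA i (≡-sym e))
  ... | tri≈ _ c≡σc _ = ≡-sym c≡σc
  ... | tri> _ _ σc<c =
    let (i , e) = complete lowers (σ M c) (subst (σ M c <_) (≡-sym (invol M c)) σc<c)
    in  ⊥-elim (notB i (≡-sym (trans (cong (σ M) e) (invol M c))))

  partition : OneRoundAcquainting G M → GoodPartition G
  partition acq = record
    { k = k ; a = a ; b = b
    ; a-inj = injective lowers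
    ; b-inj = λ i j → injective lowers i j ∘ σ-injective (a i) (a j)
    ; ab-dis = a≢b
    ; cond1 = matchedEdge
    ; cond2 = λ i j _ →
        map₂ (sym G ∘ subst (Adj G (b i)) (invol M (a j))) (acq (a i) (b j) (a≢b i j))
    ; cond3 = λ i j i≢j → acq (a i) (a j) (i≢j ∘ injective lowers i j)
    ; cond4 = λ c d (notAc , notBc) (notAd , notBd) c≢d →
        [ (λ h → h) , subst₂ (Adj G) (unmatchedFixed c notAc notBc) (unmatchedFixed d notAd notBd) ]
          (acq c d c≢d)
    ; cond5 = λ c (notA , notB) i →
        map₂ (subst (λ w → Adj G w (b i)) (unmatchedFixed c notA notB)) (acq c (a i) (notA i))
    }

module SwapMatching {n} (G : Graph n) (P : GoodPartition G) where
  open GoodPartition P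

  data Role (v : Fin n) : Set where
    inA : ∀ i → a i ≡ v → Role v
    inB : ∀ i → b i ≡ v → Role v
    inC : InC v → Role v

  role : ∀ v → Role v
  role v with any? (λ i → a i ≟ v) | any? (λ i → b i ≟ v)
  ... | yes (i , e) | _           = inA i e
  ... | no _        | yes (i , e) = inB i e
  ... | no notA     | no notB     =
    inC ((λ i e → notA (i , ≡-sym e)) , (λ i e → notB (i , ≡-sym e)))

  -- The swap: a i ↔ b i, and C is fixed.  Facts about it are proved by cases
  -- on an arbitrary role, then instantiated at role v.
  partnerOf : ∀ {v} → Role v → Fin n
  partnerOf (inA i _)  = b i
  partnerOf (inB i _)  = a i
  partnerOf {v} (inC _) = v

  partner : Fin n → Fin n
  partner v = partnerOf (role v)

  -- Roles are unique, so the partner is determined by any role.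
  partnerOf-a : ∀ i (r : Role (a i)) → partnerOf r ≡ b i
  partnerOf-a i (inA j e)        = cong b (a-inj j i e)
  partnerOf-a i (inB j e)        = ⊥-elim (ab-dis i j (≡-sym e))
  partnerOf-a i (inC (notA , _)) = ⊥-elim (notA i refl)

  partnerOf-b : ∀ i (r : Role (b i)) → partnerOf r ≡ a i
  partnerOf-b i (inA j e)        = ⊥-elim (ab-dis j i e)
  partnerOf-b i (inB j e)        = cong a (b-inj j i e)
  partnerOf-b i (inC (_ , notB)) = ⊥-elim (notB i refl)

  partnerOf-c : ∀ {c} → InC c → (r : Role c) → partnerOf r ≡ c
  partnerOf-c (notA , _) (inA i e) = ⊥-elim (notA i (≡-sym e))
  partnerOf-c (_ , notB) (inB i e) = ⊥-elim (notB i (≡-sym e))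
  partnerOf-c _          (inC _)   = refl

  partner-a : ∀ i → partner (a i) ≡ b i
  partner-a i = partnerOf-a i (role (a i))

  partner-b : ∀ i → partner (b i) ≡ a i
  partner-b i = partnerOf-b i (role (b i))

  partner-c : ∀ {c} → InC c → partner c ≡ c
  partner-c {c} inc = partnerOf-c inc (role c)

  partnerOf-invol : ∀ {v} (r : Role v) → partner (partnerOf r) ≡ v
  partnerOf-invol (inA i refl) = partner-b i
  partnerOf-invol (inB i refl) = partner-a i
  partnerOf-invol (inC inc)    = partner-c inc

  partner-invol : ∀ v → partner (partner v) ≡ v
  partner-invol v = partnerOf-invol (role v)

  partnerOf-edge : ∀ {v} (r : Role v) → partnerOf r ≢ v → Adj G v (partnerOf r)
  partnerOf-edge (inA i refl) _     = cond1 i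
  partnerOf-edge (inB i refl) _     = sym G (cond1 i)
  partnerOf-edge (inC _)      moved = ⊥-elim (moved refl)

  partner-edge : ∀ v → partner v ≢ v → Adj G v (partner v)
  partner-edge v = partnerOf-edge (role v)

  matching : Matching G
  matching = record { σ = partner ; invol = partner-invol ; isEdge = partner-edge }

  Acquainted : Fin n → Fin n → Set
  Acquainted x y = Adj G x y ⊎ Adj G (partner x) (partner y)

  acquainted-sym : ∀ {x y} → Acquainted x y → Acquainted y x
  acquainted-sym = map (sym G) (sym G)

  viaPartners : ∀ {x y x′ y′} → partner x ≡ x′ → partner y ≡ y′ →
                Adj G x y ⊎ Adj G x′ y′ → Acquainted x y
  viaPartners _  _  (inj₁ xy)   = inj₁ xy
  viaPartners px py (inj₂ x′y′) = inj₂ (subst₂ (Adj G) (≡-sym px) (≡-sym py) x′y′)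

  acquainted-aa : ∀ i j → i ≢ j → Acquainted (a i) (a j)
  acquainted-aa i j i≢j = viaPartners (partner-a i) (partner-a j) (cond3 i j i≢j)

  acquainted-bb : ∀ i j → i ≢ j → Acquainted (b i) (b j)
  acquainted-bb i j i≢j = viaPartners (partner-b i) (partner-b j) (swap (cond3 i j i≢j))

  acquainted-ab : ∀ i j → Acquainted (a i) (b j)
  acquainted-ab i j with i ≟ j
  ... | yes refl = inj₁ (cond1 i)
  ... | no i≢j   = viaPartners (partner-a i) (partner-b j) (map₂ (sym G) (cond2 i j i≢j))

  acquainted-ca : ∀ {c} → InC c → ∀ i → Acquainted c (a i)
  acquainted-ca {c} inc i = viaPartners (partner-c inc) (partner-a i) (cond5 c inc i)

  acquainted-cb : ∀ {c} → InC c → ∀ i → Acquainted c (b i)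
  acquainted-cb {c} inc i = viaPartners (partner-c inc) (partner-b i) (swap (cond5 c inc i))

  acquaintedByRoles : ∀ {x y} → Role x → Role y → x ≢ y → Acquainted x y
  acquaintedByRoles (inA i refl) (inA j refl) x≢y = acquainted-aa i j (x≢y ∘ cong a)
  acquaintedByRoles (inA i refl) (inB j refl) _   = acquainted-ab i j
  acquaintedByRoles (inB i refl) (inA j refl) _   = acquainted-sym (acquainted-ab j i)
  acquaintedByRoles (inB i refl) (inB j refl) x≢y = acquainted-bb i j (x≢y ∘ cong b)
  acquaintedByRoles (inC inc)    (inA j refl) _   = acquainted-ca inc j
  acquaintedByRoles (inC inc)    (inB j refl) _   = acquainted-cb inc j
  acquaintedByRoles (inA i refl) (inC inc)    _   = acquainted-sym (acquainted-ca inc i)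
  acquaintedByRoles (inB i refl) (inC inc)    _   = acquainted-sym (acquainted-cb inc i)
  acquaintedByRoles {x} {y} (inC incx) (inC incy) x≢y = inj₁ (cond4 x y incx incy x≢y)

  acquainting : OneRoundAcquainting G matching
  acquainting x y = acquaintedByRoles (role x) (role y)

proposition7p1 : ∀ {n : ℕ} (G : Graph n) → Connected G →
    (ACatMost G 1 → GoodPartition G) × (GoodPartition G → ACatMost G 1)
proposition7p1 G _ = fromOneRound , toOneRound
  where
  fromOneRound : ACatMost G 1 → GoodPartition G
  fromOneRound (M ∷ [] , refl , acq) = MatchedPairs.partition G M acq

  toOneRound : GoodPartition G → ACatMost G 1
  toOneRound P = SwapMatching.matching G P ∷ [] , refl , SwapMatching.acquainting G P
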